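{- Let $(W, \mathcal{L})$ be a threaded linkage of size $b$ and overlap $\alpha$ in a directed graph, and let $x, d$ be positive integers with $b \geq xd + (d-1)$. Then one of the following exists: (1) a family $\mathcal{Z}$ of $d$ closed walks of overlap $\alpha$ such that for each $Z \in \mathcal{Z}$ there is a path $P(Z) \in \mathcal{L}$ which is a subwalk of $Z$, with $P(Z) \neq P(Z')$ for distinct $Z, Z'$; or (2) an untangled threaded linkage $(W', \mathcal{L}')$ where $W'$ is a subwalk of $W$ and $\mathcal{L}' \subseteq \mathcal{L}$ has size at least $x$ (in particular $(W', \mathcal{L}')$ has overlap at most $\alpha$).
   Context: A walk is a sequence of vertices with consecutive vertices joined by arcs; a closed walk starts and ends at the same vertex; a subwalk is a contiguous segment. $\mathrm{oc}(v,W)$ is the number of occurrences of $v$ in $W$ (for a closed walk, minus one for its starting vertex). The overlap of a family $\mathcal{W}$ of walks is $\max_v \sum_{W \in \mathcal{W}} \mathrm{oc}(v,W)$; the overlap of a walk is that of the family consisting of it alone. A linkage is a set of pairwise vertex-disjoint paths. A threaded linkage is a pair $(W, \mathcal{L})$ where $\mathcal{L} = \{L_1, \dots, L_\ell\}$ is a linkage and there are paths $Q_1, \dots, Q_{\ell-1}$ (threads) with $W$ the concatenation $L_1, Q_1, L_2, \dots, Q_{\ell-1}, L_\ell$; its size is $|\mathcal{L}|$ and its overlap is that of $W$. It is untangled if for every $i$, the thread $Q_i$ intersects the rest of $W$ only in $L_i$ or $L_{i+1}$. -}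

module Defs where

open import Level using (Level)
open import Data.Nat using (ℕ; zero; suc; _+_; _∸_; _⊔_; _≤_)
open import Data.Fin using (Fin; zero; suc; inject₁)
open import Data.List using (List; []; _∷_; _++_; drop; head; last; tabulate; foldr; map; concat)
open import Data.Nat.ListAction using (sum)
open import Data.List.Membership.Propositional using (_∈_)
open import Data.List.Relation.Unary.Linked using (Linked)
open import Data.List.Relation.Unary.Unique.Propositional using (Unique)
open import Data.List.Relation.Binary.Disjoint.Propositional using (Disjoint)
open import Data.Maybe using (Maybe; just; nothing)
open import Data.Product using (Σ; ∃; ∃₂; _×_; _,_)
open import Data.Sum using (_⊎_)
open import Relation.Binary.PropositionalEquality using (_≡_; _≢_)
open import Relation.Binary.Definitions using (DecidableEquality)
open import Relation.Nullary using (yes; no)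

record Digraph (a b : Level) : Set (Level.suc (a Level.⊔ b)) where
  field
    V    : Set a
    _≟_  : DecidableEquality V
    Arc  : V → V → Set b

module _ {a b : Level} (G : Digraph a b) where
  open Digraph G

  IsWalk : List V → Set (a Level.⊔ b)
  IsWalk w = (w ≢ []) × Linked Arc w

  IsPath : List V → Set (a Level.⊔ b)
  IsPath w = IsWalk w × Unique w

  IsClosedWalk : List V → Set (a Level.⊔ b)
  IsClosedWalk w = IsWalk w × head w ≡ last w

  Subwalk : List V → List V → Set a
  Subwalk u w = ∃₂ λ xs ys → w ≡ xs ++ u ++ ys

  count : V → List V → ℕ
  count v [] = 0
  count v (u ∷ w) with v ≟ u
  ... | yes _ = suc (count v w)
  ... | no _  = count v w

  ocWalk : V → List V → ℕ
  ocWalk v w = count v w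

  -- oc(v, Z) for a closed walk Z: minus one for its starting vertex
  ocClosed : V → List V → ℕ
  ocClosed v [] = 0
  ocClosed v (u ∷ w) with v ≟ u
  ... | yes _ = count v (u ∷ w) ∸ 1
  ... | no _  = count v (u ∷ w)

  overlapOf : (V → List V → ℕ) → List (List V) → ℕ
  overlapOf oc ws = foldr _⊔_ 0 (map (λ v → sum (map (oc v) ws)) (concat ws))

  glue : List V → List V → List V
  glue u w = u ++ drop 1 w

  weave : (n : ℕ) → (Fin (suc n) → List V) → (Fin n → List V) → List V
  weave zero    L Q = L zero
  weave (suc n) L Q = glue (glue (L zero) (Q zero)) (weave n (λ i → L (suc i)) (λ i → Q (suc i)))

  record ThreadedLinkage (W : List V) : Set (a Level.⊔ b) where
    field
      n        : ℕ
      L        : Fin (suc n) → List V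
      Q        : Fin n → List V
      L-path   : ∀ i → IsPath (L i)
      Q-path   : ∀ i → IsPath (Q i)
      linkage  : ∀ i j → i ≢ j → Disjoint (L i) (L j)
      Q-start  : ∀ i → head (Q i) ≡ last (L (inject₁ i))
      Q-end    : ∀ i → last (Q i) ≡ head (L (suc i))
      W-concat : W ≡ weave n L Q

    size : ℕ
    size = suc n

    -- v lies on the rest of W, as seen from thread Qᵢ
    InRest : Fin n → V → Set a
    InRest i v = (∃ λ j → v ∈ L j) ⊎ (∃ λ j → j ≢ i × v ∈ Q j)

    Untangled : Set a
    Untangled = ∀ i v → v ∈ Q i → InRest i v → v ∈ L (inject₁ i) ⊎ v ∈ L (suc i)

  open ThreadedLinkage public

module Submission where

-- Cut the linkage into consecutive blocks of x paths separated by single threads. An untangled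
-- block is the threaded linkage of (2). Otherwise some thread Qᵢ of the block meets the rest of
-- the block's walk at a vertex v outside Lᵢ and Lᵢ₊₁; the two occurrences of v enclose Lᵢ or
-- Lᵢ₊₁, giving a closed subwalk through a path of that block. The blocks occupy disjoint
-- stretches of W, so d tangled blocks give the d closed walks of (1) with occurrence counts
-- adding up to at most those in W; hence already d·x ≤ b suffices.

open import Defs
open import Level using (Level; _⊔_)
open import Data.Nat using (ℕ; zero; suc; _+_; _*_; _∸_; _≤_; z≤n; s≤s) renaming (_⊔_ to _⊔ℕ_)
open import Data.Nat.Properties
  using (≤-refl; ≤-reflexive; ≤-trans; m≤m+n; m≤n+m; +-mono-≤; +-monoˡ-≤; ⊔-lub; m≤m⊔n; m≤n⊔m;
         n≤1+n; +-assoc; +-identityʳ; *-comm; m≤n⇒∃[o]m+o≡n; module ≤-Reasoning)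
open import Data.Nat.ListAction using (sum)
open import Data.Fin using (Fin; zero; suc; inject₁; _↑ˡ_; _↑ʳ_)
open import Data.Fin.Properties using (suc-injective; ↑ˡ-injective; ↑ʳ-injective; any?; all?; ¬∀⟶∃¬)
  renaming (_≟_ to _≟ᶠ_)
open import Data.List using (List; []; _∷_; _++_; drop; head; last; tabulate; foldr; map; concat)
open import Data.List.Properties using (++-assoc; ++-identityʳ)
open import Data.List.Membership.Propositional using (_∈_; _∉_; find)
open import Data.List.Membership.Propositional.Properties using (∈-++⁺ˡ; ∈-++⁺ʳ; ∈-++⁻; ∈-∃++)
open import Data.List.Relation.Binary.Subset.Propositional using (_⊆_)
open import Data.List.Relation.Unary.Any using (here; there)
open import Data.List.Relation.Unary.All as All using (All)
open import Data.List.Relation.Unary.All.Properties using (¬All⇒Any¬)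
open import Data.List.Relation.Unary.Linked as Linked using (Linked; []; [-]; _∷_)
open import Data.List.Relation.Binary.Disjoint.Propositional using (Disjoint)
open import Data.Maybe using (just)
open import Data.Product using (Σ; ∃; ∃₂; ∃-syntax; _×_; _,_)
open import Data.Sum using (_⊎_; inj₁; inj₂; map₂)
open import Function using (_∘_; id)
open import Function.Definitions using (Injective)
open import Relation.Binary.PropositionalEquality
  using (_≡_; _≢_; refl; sym; trans; cong; subst; module ≡-Reasoning)
open import Relation.Nullary using (¬_; Dec; yes; no; contradiction)
open import Relation.Nullary.Decidable using (_×-dec_; _⊎-dec_; _→-dec_; ¬?)
open import Relation.Unary using (Decidable)

¬[→⊎]⇒×¬¬ : ∀ {p q r} {P : Set p} {Q : Set q} {R : Set r} →
  Dec P → ¬ (P → Q ⊎ R) → P × ¬ Q × ¬ R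
¬[→⊎]⇒×¬¬ (yes p) ¬f = p , (λ q → ¬f λ _ → inj₁ q) , (λ r → ¬f λ _ → inj₂ r)
¬[→⊎]⇒×¬¬ (no ¬p) ¬f = contradiction (λ p → contradiction p ¬p) ¬f

module _ {c} {A : Set c} where

  last-∷ʳ : ∀ (xs : List A) v → last (xs ++ v ∷ []) ≡ just v
  last-∷ʳ []           v = refl
  last-∷ʳ (_ ∷ [])     v = refl
  last-∷ʳ (_ ∷ y ∷ xs) v = last-∷ʳ (y ∷ xs) v

  last-++-∷ : ∀ (xs : List A) y ys → last (xs ++ y ∷ ys) ≡ last (y ∷ ys)
  last-++-∷ []           y ys = refl
  last-++-∷ (_ ∷ [])     y ys = refl
  last-++-∷ (_ ∷ x ∷ xs) y ys = last-++-∷ (x ∷ xs) y ys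

  last⇒∷ʳ : ∀ (xs : List A) {v} → last xs ≡ just v → ∃ λ ys → xs ≡ ys ++ v ∷ []
  last⇒∷ʳ (_ ∷ [])     refl = [] , refl
  last⇒∷ʳ (x ∷ y ∷ xs) eq   with last⇒∷ʳ (y ∷ xs) eq
  ... | ys , xs≡ = x ∷ ys , cong (x ∷_) xs≡

  ++-≢[] : ∀ {xs ys : List A} → xs ≢ [] → xs ++ ys ≢ []
  ++-≢[] {[]}    xs≢[] = contradiction refl xs≢[]
  ++-≢[] {_ ∷ _} _     ()

  head-++ : ∀ {xs ys : List A} → xs ≢ [] → head (xs ++ ys) ≡ head xs
  head-++ {[]}    xs≢[] = contradiction refl xs≢[]
  head-++ {_ ∷ _} _     = refl

  drop₁-++ : ∀ {xs : List A} ys → xs ≢ [] → drop 1 (xs ++ ys) ≡ drop 1 xs ++ ys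
  drop₁-++ {[]}    ys xs≢[] = contradiction refl xs≢[]
  drop₁-++ {_ ∷ _} ys _     = refl

  foldr-⊔-≤ : ∀ (f : A → ℕ) xs {k} → (∀ x → f x ≤ k) → foldr _⊔ℕ_ 0 (map f xs) ≤ k
  foldr-⊔-≤ f []       f≤k = z≤n
  foldr-⊔-≤ f (x ∷ xs) f≤k = ⊔-lub (f≤k x) (foldr-⊔-≤ f xs f≤k)

  ≤-foldr-⊔ : ∀ (f : A → ℕ) {xs x} → x ∈ xs → f x ≤ foldr _⊔ℕ_ 0 (map f xs)
  ≤-foldr-⊔ f (here refl) = m≤m⊔n _ _
  ≤-foldr-⊔ f (there x∈xs) = ≤-trans (≤-foldr-⊔ f x∈xs) (m≤n⊔m _ _)

  module _ {r} {R : A → A → Set r} where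

    Linked-++⁻ˡ : ∀ xs {ys} → Linked R (xs ++ ys) → Linked R xs
    Linked-++⁻ˡ []           _        = []
    Linked-++⁻ˡ (_ ∷ [])     _        = [-]
    Linked-++⁻ˡ (_ ∷ y ∷ xs) (r ∷ rs) = r ∷ Linked-++⁻ˡ (y ∷ xs) rs

    Linked-++⁻ʳ : ∀ xs {ys} → Linked R (xs ++ ys) → Linked R ys
    Linked-++⁻ʳ []       rs = rs
    Linked-++⁻ʳ (_ ∷ xs) rs = Linked-++⁻ʳ xs (Linked.tail rs)

↑ˡ≢↑ʳ : ∀ {m k} (i : Fin m) (j : Fin k) → i ↑ˡ k ≢ m ↑ʳ j
↑ˡ≢↑ʳ zero    j ()
↑ˡ≢↑ʳ (suc i) j eq = ↑ˡ≢↑ʳ i j (suc-injective eq)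

inject₁-↑ˡ : ∀ {m} (i : Fin m) k → inject₁ (i ↑ˡ k) ≡ inject₁ i ↑ˡ k
inject₁-↑ˡ zero    k = refl
inject₁-↑ˡ (suc i) k = cong suc (inject₁-↑ˡ i k)

inject₁-↑ʳ : ∀ m {k} (j : Fin k) → inject₁ (m ↑ʳ suc j) ≡ suc m ↑ʳ inject₁ j
inject₁-↑ʳ zero    j = refl
inject₁-↑ʳ (suc m) j = cong suc (inject₁-↑ʳ m j)

module _ {a b : Level} (G : Digraph a b) where
  open Digraph G
  open import Data.List.Membership.DecPropositional _≟_ using (_∈?_)

  Subwalk-trans : ∀ {u w z} → Subwalk G u w → Subwalk G w z → Subwalk G u z
  Subwalk-trans {u} {w} {z} (xs , ys , w≡) (xs′ , ys′ , z≡) = xs′ ++ xs , ys ++ ys′ , (begin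
    z                              ≡⟨ z≡ ⟩
    xs′ ++ w ++ ys′                ≡⟨ cong (λ t → xs′ ++ t ++ ys′) w≡ ⟩
    xs′ ++ (xs ++ u ++ ys) ++ ys′  ≡⟨ cong (xs′ ++_) (++-assoc xs (u ++ ys) ys′) ⟩
    xs′ ++ xs ++ (u ++ ys) ++ ys′  ≡⟨ cong (λ t → xs′ ++ xs ++ t) (++-assoc u ys ys′) ⟩
    xs′ ++ xs ++ u ++ ys ++ ys′    ≡⟨ ++-assoc xs′ xs _ ⟨
    (xs′ ++ xs) ++ u ++ ys ++ ys′  ∎)
    where open ≡-Reasoning

  Subwalk⇒⊆ : ∀ {u w} → Subwalk G u w → u ⊆ w
  Subwalk⇒⊆ {u} (xs , ys , refl) = ∈-++⁺ʳ xs ∘ ∈-++⁺ˡ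

  Subwalk⇒Linked : ∀ {u w} → Subwalk G u w → Linked Arc w → Linked Arc u
  Subwalk⇒Linked {u} (xs , ys , refl) = Linked-++⁻ˡ u ∘ Linked-++⁻ʳ xs

  Subwalk-drop₁ : ∀ {u w} → u ≢ [] → Subwalk G u w → Subwalk G (drop 1 u) (drop 1 w)
  Subwalk-drop₁ {[]}    u≢[] _                 = contradiction refl u≢[]
  Subwalk-drop₁ {v ∷ u} _    ([]      , ys , refl) = [] , ys , refl
  Subwalk-drop₁ {v ∷ u} _    (_ ∷ xs , ys , refl) = xs ++ v ∷ [] , ys , sym (++-assoc xs (v ∷ []) _)

  glue-overlap : ∀ u {h} t → last u ≡ just h →
    ∃ λ u′ → u ≡ u′ ++ h ∷ [] × glue G u (h ∷ t) ≡ u′ ++ h ∷ t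
  glue-overlap u {h} t eq with last⇒∷ʳ u eq
  ... | u′ , refl = u′ , refl , ++-assoc u′ (h ∷ []) t

  glue-through : ∀ u M r → M ≢ [] → head M ≡ last u →
    ∃ λ u′ → glue G u (M ++ r) ≡ u′ ++ M ++ r × (∀ {v} → v ∈ u → v ∈ u′ ⊎ v ∈ M)
  glue-through u []      r M≢[] _  = contradiction refl M≢[]
  glue-through u (h ∷ M) r _    eq with glue-overlap u (M ++ r) (sym eq)
  ... | u′ , refl , glue≡ =
    u′ , glue≡ , λ v∈u → map₂ (λ { (here v≡h) → here v≡h }) (∈-++⁻ u′ v∈u)

  glue-Subwalkʳ : ∀ u w → head w ≡ last u → Subwalk G w (glue G u w)
  glue-Subwalkʳ u []      _  = glue G u [] , [] , sym (++-identityʳ _)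
  glue-Subwalkʳ u (h ∷ t) eq with glue-overlap u t (sym eq)
  ... | u′ , _ , glue≡ = u′ , [] , trans glue≡ (cong (u′ ++_) (sym (++-identityʳ (h ∷ t))))

  glue-assoc : ∀ u v w → v ≢ [] → glue G (glue G u v) w ≡ glue G u (glue G v w)
  glue-assoc u []      w v≢[] = contradiction refl v≢[]
  glue-assoc u (_ ∷ v) w _    = ++-assoc u v (drop 1 w)

  glue-≢[] : ∀ {u} w → u ≢ [] → glue G u w ≢ []
  glue-≢[] {[]}    w u≢[] = contradiction refl u≢[]
  glue-≢[] {_ ∷ _} w _    ()

  last-glue : ∀ u w → head w ≡ last u → last (glue G u w) ≡ last w
  last-glue u []          eq rewrite ++-identityʳ u = sym eq
  last-glue u (_ ∷ [])    eq rewrite ++-identityʳ u = sym eq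
  last-glue u (_ ∷ h ∷ t) eq = last-++-∷ u h t

  Linked-glue : ∀ {u w} → Linked Arc u → Linked Arc w → head w ≡ last u → Linked Arc (glue G u w)
  Linked-glue {u} {[]}    ru _  _ rewrite ++-identityʳ u = ru
  Linked-glue {_ ∷ []} {_ ∷ _} _  rw refl = rw
  Linked-glue {_ ∷ v ∷ u} (r ∷ ru) rw eq   = r ∷ Linked-glue ru rw eq

  count-++ : ∀ v xs ys → count G v (xs ++ ys) ≡ count G v xs + count G v ys
  count-++ v []       ys = refl
  count-++ v (u ∷ xs) ys with v ≟ u
  ... | yes _ = cong suc (count-++ v xs ys)
  ... | no _  = count-++ v xs ys

  count-drop₁ : ∀ v w → count G v (drop 1 w) ≤ count G v w
  count-drop₁ v []      = z≤n
  count-drop₁ v (u ∷ w) with v ≟ u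
  ... | yes _ = n≤1+n _
  ... | no _  = ≤-refl

  ocClosed-∷ : ∀ v u w → ocClosed G v (u ∷ w) ≡ count G v w
  ocClosed-∷ v u w with v ≟ u
  ... | yes v≡u = cong (_∸ 1) (count-here v≡u)
    where
    count-here : v ≡ u → count G v (u ∷ w) ≡ suc (count G v w)
    count-here v≡u with v ≟ u
    ... | yes _   = refl
    ... | no v≢u  = contradiction v≡u v≢u
  ... | no v≢u with v ≟ u
  ...   | yes v≡u = contradiction v≡u v≢u
  ...   | no _    = refl

  count-Subwalk : ∀ v {u w} → Subwalk G u w → count G v u ≤ count G v w
  count-Subwalk v {u} (xs , ys , refl)
    rewrite count-++ v xs (u ++ ys) | count-++ v u ys =
    ≤-trans (m≤m+n (count G v u) (count G v ys)) (m≤n+m _ (count G v xs))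

  count-drop₁-glue : ∀ v {u} w → u ≢ [] →
    count G v (drop 1 (glue G u w)) ≡ count G v (drop 1 u) + count G v (drop 1 w)
  count-drop₁-glue v {[]}    w u≢[] = contradiction refl u≢[]
  count-drop₁-glue v {_ ∷ u} w _    = count-++ v u (drop 1 w)

  ∈⊎count≡0 : ∀ v w → v ∈ w ⊎ count G v w ≡ 0
  ∈⊎count≡0 v []      = inj₂ refl
  ∈⊎count≡0 v (u ∷ w) with v ≟ u | ∈⊎count≡0 v w
  ... | yes v≡u | _          = inj₁ (here v≡u)
  ... | no _    | inj₁ v∈w   = inj₁ (there v∈w)
  ... | no _    | inj₂ c≡0   = inj₂ c≡0

  count≤overlapOf : ∀ v w → count G v w ≤ overlapOf G (ocWalk G) (w ∷ [])
  count≤overlapOf v w with ∈⊎count≡0 v w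
  ... | inj₂ c≡0 rewrite c≡0 = z≤n
  ... | inj₁ v∈w = subst (_≤ _) (+-identityʳ _) (≤-foldr-⊔ (λ u → count G u w + 0) (∈-++⁺ˡ v∈w))

  overlapOf-≤ : ∀ (oc : V → List V → ℕ) ws {k} →
    (∀ v → sum (map (oc v) ws) ≤ k) → overlapOf G oc ws ≤ k
  overlapOf-≤ oc ws bound = foldr-⊔-≤ (λ v → sum (map (oc v) ws)) (concat ws) bound

  ClosedSubwalk : (W M : List V) → Set a
  ClosedSubwalk W M = Σ (List V) λ Z → Subwalk G Z W × Z ≢ [] × head Z ≡ last Z × Subwalk G M Z

  ClosedSubwalkThrough : List V → ∀ {n} → (Fin n → List V) → Set a
  ClosedSubwalkThrough W P = ∃ λ p → ClosedSubwalk W (P p)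

  ClosedSubwalk-⊑ : ∀ {W W′ M} → Subwalk G W W′ → ClosedSubwalk W M → ClosedSubwalk W′ M
  ClosedSubwalk-⊑ W⊑W′ (Z , Z⊑W , rest) = Z , Subwalk-trans Z⊑W W⊑W′ , rest

  -- Cut the walk at the two occurrences of v: Z = v A₂ M B₁ v.
  repeat⇒ClosedSubwalk : ∀ A M B {v} → v ∈ A → v ∈ B → ClosedSubwalk (A ++ M ++ B) M
  repeat⇒ClosedSubwalk A M B {v} v∈A v∈B with ∈-∃++ v∈A | ∈-∃++ v∈B
  ... | A₁ , A₂ , refl | B₁ , B₂ , refl =
    Z , (A₁ , B₂ , W≡) , (λ ()) , Z-closed , (v ∷ A₂ , B₁ ++ v ∷ [] , refl)
    where
    open ≡-Reasoning
    Z = v ∷ A₂ ++ M ++ B₁ ++ v ∷ []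
    Z-closed : head Z ≡ last Z
    Z-closed = begin
      just v                         ≡⟨ last-∷ʳ (v ∷ A₂ ++ M ++ B₁) v ⟨
      last ((v ∷ A₂ ++ M ++ B₁) ++ v ∷ [])
        ≡⟨ cong (λ t → last (v ∷ t)) (trans (++-assoc A₂ _ _) (cong (A₂ ++_) (++-assoc M B₁ _))) ⟩
      last Z                         ∎
    W≡ : (A₁ ++ v ∷ A₂) ++ M ++ B₁ ++ v ∷ B₂ ≡ A₁ ++ Z ++ B₂
    W≡ = begin
      (A₁ ++ v ∷ A₂) ++ M ++ B₁ ++ v ∷ B₂
        ≡⟨ ++-assoc A₁ (v ∷ A₂) _ ⟩
      A₁ ++ v ∷ A₂ ++ M ++ B₁ ++ v ∷ B₂
        ≡⟨ cong (λ t → A₁ ++ v ∷ A₂ ++ M ++ t) (++-assoc B₁ (v ∷ []) B₂) ⟨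
      A₁ ++ v ∷ A₂ ++ M ++ (B₁ ++ v ∷ []) ++ B₂
        ≡⟨ cong (λ t → A₁ ++ v ∷ A₂ ++ t) (++-assoc M _ B₂) ⟨
      A₁ ++ v ∷ A₂ ++ (M ++ B₁ ++ v ∷ []) ++ B₂
        ≡⟨ cong (λ t → A₁ ++ v ∷ t) (++-assoc A₂ _ B₂) ⟨
      A₁ ++ Z ++ B₂
        ∎

  glue-repeat⇒ClosedSubwalk : ∀ u M r {v} → M ≢ [] → head M ≡ last u →
    v ∈ u → v ∉ M → v ∈ M ++ r → ClosedSubwalk (glue G u (M ++ r)) M
  glue-repeat⇒ClosedSubwalk u M r M≢[] join v∈u v∉M v∈M++r with glue-through u M r M≢[] join
  ... | u′ , glue≡ , u⊆u′∪M with u⊆u′∪M v∈u | ∈-++⁻ M v∈M++r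
  ...   | inj₂ v∈M  | _        = contradiction v∈M v∉M
  ...   | inj₁ _    | inj₁ v∈M = contradiction v∈M v∉M
  ...   | inj₁ v∈u′ | inj₂ v∈r =
    subst (λ W → ClosedSubwalk W M) (sym glue≡) (repeat⇒ClosedSubwalk u′ M r v∈u′ v∈r)

  -- A threaded linkage indexed by its number of threads, with its walk computed rather than
  -- given, so that it can be cut into a prefix and a suffix.
  record Chain (n : ℕ) : Set (a ⊔ b) where
    field
      path          : Fin (suc n) → List V
      thread        : Fin n → List V
      path-isPath   : ∀ i → IsPath G (path i)
      thread-isPath : ∀ i → IsPath G (thread i)
      disjoint      : ∀ i j → i ≢ j → Disjoint (path i) (path j)
      thread-start  : ∀ i → head (thread i) ≡ last (path (inject₁ i))
      thread-end    : ∀ i → last (thread i) ≡ head (path (suc i))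

    walk : List V
    walk = weave G n path thread

    path-≢[] : ∀ i → path i ≢ []
    path-≢[] i = let (≢[] , _) , _ = path-isPath i in ≢[]

    path-linked : ∀ i → Linked Arc (path i)
    path-linked i = let (_ , linked) , _ = path-isPath i in linked

    thread-linked : ∀ i → Linked Arc (thread i)
    thread-linked i = let (_ , linked) , _ = thread-isPath i in linked

  open Chain public

  toThreadedLinkage : ∀ {n} (R : Chain n) → ThreadedLinkage G (walk R)
  toThreadedLinkage {n} R = record
    { n = n ; L = path R ; Q = thread R ; L-path = path-isPath R ; Q-path = thread-isPath R
    ; linkage = disjoint R ; Q-start = thread-start R ; Q-end = thread-end R ; W-concat = refl }

  fromThreadedLinkage : ∀ {W} (T : ThreadedLinkage G W) → Chain (n T)
  fromThreadedLinkage T = record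
    { path = L T ; thread = Q T ; path-isPath = L-path T ; thread-isPath = Q-path T
    ; disjoint = linkage T ; thread-start = Q-start T ; thread-end = Q-end T }

  tail : ∀ {n} → Chain (suc n) → Chain n
  tail R = record
    { path = path R ∘ suc ; thread = thread R ∘ suc
    ; path-isPath = path-isPath R ∘ suc ; thread-isPath = thread-isPath R ∘ suc
    ; disjoint = λ i j i≢j → disjoint R (suc i) (suc j) (i≢j ∘ suc-injective)
    ; thread-start = thread-start R ∘ suc ; thread-end = thread-end R ∘ suc }

  prefix : ∀ m {k} → Chain (m + k) → Chain m
  prefix m {k} R = record
    { path = path R ∘ (_↑ˡ k) ; thread = thread R ∘ (_↑ˡ k)
    ; path-isPath = path-isPath R ∘ (_↑ˡ k) ; thread-isPath = thread-isPath R ∘ (_↑ˡ k)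
    ; disjoint = λ i j i≢j → disjoint R (i ↑ˡ k) (j ↑ˡ k) (i≢j ∘ ↑ˡ-injective k i j)
    ; thread-start = λ i → trans (thread-start R (i ↑ˡ k)) (cong (last ∘ path R) (inject₁-↑ˡ i k))
    ; thread-end = thread-end R ∘ (_↑ˡ k) }

  suffix : ∀ m {k} → Chain (m + suc k) → Chain k
  suffix m {k} R = record
    { path = path R ∘ (suc m ↑ʳ_) ; thread = thread R ∘ (m ↑ʳ_) ∘ suc
    ; path-isPath = path-isPath R ∘ (suc m ↑ʳ_) ; thread-isPath = thread-isPath R ∘ (m ↑ʳ_) ∘ suc
    ; disjoint = λ i j i≢j → disjoint R (suc m ↑ʳ i) (suc m ↑ʳ j) (i≢j ∘ ↑ʳ-injective (suc m) i j)
    ; thread-start = λ j → trans (thread-start R (m ↑ʳ suc j)) (cong (last ∘ path R) (inject₁-↑ʳ m j))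
    ; thread-end = thread-end R ∘ (m ↑ʳ_) ∘ suc }

  firstSegment : ∀ {n} → Chain (suc n) → List V
  firstSegment R = glue G (path R zero) (thread R zero)

  thread₀⊆firstSegment : ∀ {n} (R : Chain (suc n)) → thread R zero ⊆ firstSegment R
  thread₀⊆firstSegment R = Subwalk⇒⊆ (glue-Subwalkʳ (path R zero) (thread R zero) (thread-start R zero))

  walk-head : ∀ {n} (R : Chain n) → ∃ λ r → walk R ≡ path R zero ++ r
  walk-head {zero}  R = [] , sym (++-identityʳ _)
  walk-head {suc n} R = _ , ++-assoc (path R zero) _ _

  walk-≢[] : ∀ {n} (R : Chain n) → walk R ≢ []
  walk-≢[] R walk≡[] with walk-head R
  ... | r , eq = ++-≢[] (path-≢[] R zero) (trans (sym eq) walk≡[])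

  head-walk : ∀ {n} (R : Chain n) → head (walk R) ≡ head (path R zero)
  head-walk R with walk-head R
  ... | r , eq = trans (cong head eq) (head-++ (path-≢[] R zero))

  walk-join : ∀ {n} (R : Chain (suc n)) → head (walk (tail R)) ≡ last (firstSegment R)
  walk-join R = begin
    head (walk (tail R))    ≡⟨ head-walk (tail R) ⟩
    head (path R (suc zero)) ≡⟨ thread-end R zero ⟨
    last (thread R zero)     ≡⟨ last-glue (path R zero) (thread R zero) (thread-start R zero) ⟨
    last (firstSegment R)    ∎
    where open ≡-Reasoning

  walk-linked : ∀ {n} (R : Chain n) → Linked Arc (walk R)
  walk-linked {zero}  R = path-linked R zero
  walk-linked {suc n} R = Linked-glue
    (Linked-glue (path-linked R zero) (thread-linked R zero) (thread-start R zero))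
    (walk-linked (tail R)) (walk-join R)

  tail-Subwalk : ∀ {n} (R : Chain (suc n)) → Subwalk G (walk (tail R)) (walk R)
  tail-Subwalk R = glue-Subwalkʳ (firstSegment R) (walk (tail R)) (walk-join R)

  path⊆walk : ∀ {n} (R : Chain n) j → path R j ⊆ walk R
  path⊆walk {zero}  R zero    = id
  path⊆walk {suc n} R zero    = ∈-++⁺ˡ ∘ ∈-++⁺ˡ
  path⊆walk {suc n} R (suc j) = Subwalk⇒⊆ (tail-Subwalk R) ∘ path⊆walk (tail R) j

  thread⊆walk : ∀ {n} (R : Chain n) j → thread R j ⊆ walk R
  thread⊆walk {suc n} R zero    = ∈-++⁺ˡ ∘ thread₀⊆firstSegment R
  thread⊆walk {suc n} R (suc j) = Subwalk⇒⊆ (tail-Subwalk R) ∘ thread⊆walk (tail R) j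

  walk-prefix : ∀ m {k} (R : Chain (m + k)) → ∃ λ r → walk R ≡ walk (prefix m R) ++ r
  walk-prefix zero    R = walk-head R
  walk-prefix (suc m) R with walk-prefix m (tail R)
  ... | r , eq = r , (begin
    glue G S (walk (tail R))          ≡⟨ cong (glue G S) eq ⟩
    S ++ drop 1 (X ++ r)              ≡⟨ cong (S ++_) (drop₁-++ r (walk-≢[] (prefix m (tail R)))) ⟩
    S ++ drop 1 X ++ r                ≡⟨ ++-assoc S (drop 1 X) r ⟨
    glue G S X ++ r                   ∎)
    where
    open ≡-Reasoning
    S = firstSegment R
    X = walk (prefix m (tail R))

  walk-split : ∀ m {k} (R : Chain (m + suc k)) →
    walk R ≡ glue G (glue G (walk (prefix m R)) (thread R (m ↑ʳ zero))) (walk (suffix m R))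
  walk-split zero    R = refl
  walk-split (suc m) R = begin
    glue G S (walk (tail R))           ≡⟨ cong (glue G S) (walk-split m (tail R)) ⟩
    glue G S (glue G (glue G X q) Y)   ≡⟨ glue-assoc S (glue G X q) Y (glue-≢[] q X≢[]) ⟨
    glue G (glue G S (glue G X q)) Y   ≡⟨ cong (λ t → glue G t Y) (glue-assoc S X q X≢[]) ⟨
    glue G (glue G (glue G S X) q) Y   ∎
    where
    open ≡-Reasoning
    S = firstSegment R
    X = walk (prefix m (tail R))
    q = thread R (suc m ↑ʳ zero)
    Y = walk (suffix m (tail R))
    X≢[] = walk-≢[] (prefix m (tail R))

  prefix-Subwalk : ∀ m {k} (R : Chain (m + k)) → Subwalk G (walk (prefix m R)) (walk R)
  prefix-Subwalk m R with walk-prefix m R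
  ... | r , eq = [] , r , eq

  suffix-Subwalk : ∀ m {k} (R : Chain (m + suc k)) → Subwalk G (walk (suffix m R)) (walk R)
  suffix-Subwalk zero    R = tail-Subwalk R
  suffix-Subwalk (suc m) R = Subwalk-trans (suffix-Subwalk m (tail R)) (tail-Subwalk R)

  closedSubwalk-aroundPath₁ : ∀ {n} (R : Chain (suc n)) {v} → v ∈ firstSegment R →
    v ∈ walk (tail R) → v ∉ path R (suc zero) → ClosedSubwalkThrough (walk R) (path R)
  closedSubwalk-aroundPath₁ R v∈S v∈rest v∉L₁ with walk-head (tail R)
  ... | r , rest≡ = suc zero , subst (λ W → ClosedSubwalk W (path R (suc zero))) W≡
    (glue-repeat⇒ClosedSubwalk (firstSegment R) (path R (suc zero)) r (path-≢[] R (suc zero))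
      (trans (sym (head-walk (tail R))) (walk-join R)) v∈S v∉L₁ (subst (_ ∈_) rest≡ v∈rest))
    where
    W≡ : glue G (firstSegment R) (path R (suc zero) ++ r) ≡ walk R
    W≡ = cong (glue G (firstSegment R)) (sym rest≡)

  inTail : ∀ {n} (R : Chain (suc n)) → ClosedSubwalkThrough (walk (tail R)) (path (tail R)) →
    ClosedSubwalkThrough (walk R) (path R)
  inTail R (p , Z) = suc p , ClosedSubwalk-⊑ (tail-Subwalk R) Z

  Tangle : ∀ {n} (R : Chain n) → Fin n → V → Set a
  Tangle R i v = v ∈ thread R i × InRest (toThreadedLinkage R) i v ×
                 v ∉ path R (inject₁ i) × v ∉ path R (suc i)

  -- v lies on Qᵢ and elsewhere on W but on neither end of Qᵢ, so one of Lᵢ, Lᵢ₊₁ lies strictly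
  -- between two occurrences of v.
  tangle⇒ClosedSubwalk : ∀ {n} (R : Chain n) i {v} → Tangle R i v → ClosedSubwalkThrough (walk R) (path R)
  tangle⇒ClosedSubwalk {suc n} R zero (v∈Q , inj₁ (zero , v∈L) , v∉L₀ , _) = contradiction v∈L v∉L₀
  tangle⇒ClosedSubwalk {suc n} R zero (v∈Q , inj₁ (suc zero , v∈L) , _ , v∉L₁) = contradiction v∈L v∉L₁
  tangle⇒ClosedSubwalk {suc n} R zero (v∈Q , inj₁ (suc (suc j) , v∈L) , _ , v∉L₁) =
    closedSubwalk-aroundPath₁ R (thread₀⊆firstSegment R v∈Q) (path⊆walk (tail R) (suc j) v∈L) v∉L₁
  tangle⇒ClosedSubwalk {suc n} R zero (v∈Q , inj₂ (zero , 0≢0 , _) , _) = contradiction refl 0≢0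
  tangle⇒ClosedSubwalk {suc n} R zero (v∈Q , inj₂ (suc j , _ , v∈Qⱼ) , _ , v∉L₁) =
    closedSubwalk-aroundPath₁ R (thread₀⊆firstSegment R v∈Q) (thread⊆walk (tail R) j v∈Qⱼ) v∉L₁
  tangle⇒ClosedSubwalk {suc n} R (suc i) (v∈Q , inj₁ (zero , v∈L₀) , _) =
    closedSubwalk-aroundPath₁ R (∈-++⁺ˡ v∈L₀) (thread⊆walk (tail R) i v∈Q)
      (λ v∈L₁ → disjoint R zero (suc zero) (λ ()) (v∈L₀ , v∈L₁))
  tangle⇒ClosedSubwalk {suc n} R (suc i) (v∈Q , inj₁ (suc j , v∈L) , v∉Lᵢ) =
    inTail R (tangle⇒ClosedSubwalk (tail R) i (v∈Q , inj₁ (j , v∈L) , v∉Lᵢ))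
  tangle⇒ClosedSubwalk {suc n} R (suc i) {v} (v∈Q , inj₂ (zero , _ , v∈Q₀) , v∉Lᵢ)
    with v ∈? path R (suc zero)
  ... | yes v∈L₁ = inTail R (tangle⇒ClosedSubwalk (tail R) i (v∈Q , inj₁ (zero , v∈L₁) , v∉Lᵢ))
  ... | no v∉L₁  =
    closedSubwalk-aroundPath₁ R (thread₀⊆firstSegment R v∈Q₀) (thread⊆walk (tail R) i v∈Q) v∉L₁
  tangle⇒ClosedSubwalk {suc n} R (suc i) (v∈Q , inj₂ (suc j , j≢i , v∈Qⱼ) , v∉Lᵢ) =
    inTail R (tangle⇒ClosedSubwalk (tail R) i (v∈Q , inj₂ (j , j≢i ∘ cong suc , v∈Qⱼ) , v∉Lᵢ))

  InRest? : ∀ {n} (R : Chain n) i v → Dec (InRest (toThreadedLinkage R) i v)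
  InRest? R i v = any? (λ j → v ∈? path R j) ⊎-dec any? (λ j → ¬? (j ≟ᶠ i) ×-dec v ∈? thread R j)

  module _ {n} (R : Chain n) where
    private
      Clean : Fin n → V → Set a
      Clean i v = InRest (toThreadedLinkage R) i v → v ∈ path R (inject₁ i) ⊎ v ∈ path R (suc i)

      clean? : ∀ i → Decidable (Clean i)
      clean? i v = InRest? R i v →-dec (v ∈? path R (inject₁ i) ⊎-dec v ∈? path R (suc i))

      threadClean? : Decidable (λ i → All (Clean i) (thread R i))
      threadClean? i = All.all? (clean? i) (thread R i)

    untangled⊎tangle : Untangled (toThreadedLinkage R) ⊎ ∃₂ (Tangle R)
    untangled⊎tangle with all? threadClean?
    ... | yes clean = inj₁ λ i v → All.lookup (clean i)
    ... | no ¬clean with ¬∀⟶∃¬ n _ threadClean? ¬clean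
    ...   | i , ¬cleanᵢ with find (¬All⇒Any¬ (clean? i) (thread R i) ¬cleanᵢ)
    ...     | v , v∈Q , ¬cleanᵢᵥ = inj₂ (i , v , v∈Q , ¬[→⊎]⇒×¬¬ (InRest? R i v) ¬cleanᵢᵥ)

  untangled⊎ClosedSubwalk : ∀ {n} (R : Chain n) →
    Untangled (toThreadedLinkage R) ⊎ ClosedSubwalkThrough (walk R) (path R)
  untangled⊎ClosedSubwalk R =
    map₂ (λ (i , _ , tangle) → tangle⇒ClosedSubwalk R i tangle) (untangled⊎tangle R)

  UntangledSublinkage : ℕ → List V → ∀ {n} → (Fin n → List V) → Set (a ⊔ b)
  UntangledSublinkage x W P = Σ (List V) λ W′ → Σ (ThreadedLinkage G W′) λ T′ →
    Subwalk G W′ W × (∀ i → ∃[ j ] L T′ i ≡ P j) × x ≤ size T′ × Untangled T′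

  UntangledSublinkage-⊑ : ∀ {x W W′ n n′} {P : Fin n → List V} {P′ : Fin n′ → List V} →
    Subwalk G W W′ → (∀ i → ∃[ j ] P i ≡ P′ j) →
    UntangledSublinkage x W P → UntangledSublinkage x W′ P′
  UntangledSublinkage-⊑ {P′ = P′} W⊑W′ P⊆P′ (W″ , T , W″⊑W , T⊆P , x≤size , untangled) =
    W″ , T , Subwalk-trans W″⊑W W⊑W′ , T⊆P′ , x≤size , untangled
    where
    T⊆P′ : ∀ i → ∃[ j ] L T i ≡ P′ j
    T⊆P′ i = let j , Tᵢ≡Pⱼ = T⊆P i ; j′ , Pⱼ≡P′ⱼ′ = P⊆P′ j in j′ , trans Tᵢ≡Pⱼ Pⱼ≡P′ⱼ′

  -- Occurrences are bounded by those in W without its first vertex, a count that is additive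
  -- under glue.
  ClosedWalkFamily : ℕ → List V → ∀ {n} → (Fin n → List V) → Set (a ⊔ b)
  ClosedWalkFamily d W {n} P = Σ (Fin d → List V) λ Z →
    (∀ i → IsClosedWalk G (Z i)) ×
    (∀ v → sum (map (ocClosed G v) (tabulate Z)) ≤ count G v (drop 1 W)) ×
    Σ (Fin d → Fin n) λ σ → Injective _≡_ _≡_ σ × (∀ i → Subwalk G (P (σ i)) (Z i))

  ocClosed-Subwalk : ∀ v {Z W} → Z ≢ [] → Subwalk G Z W → ocClosed G v Z ≤ count G v (drop 1 W)
  ocClosed-Subwalk v {[]}    Z≢[] _   = contradiction refl Z≢[]
  ocClosed-Subwalk v {z ∷ Z} _    Z⊑W rewrite ocClosed-∷ v z Z = count-Subwalk v (Subwalk-drop₁ (λ ()) Z⊑W)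

  ClosedWalkFamily-[] : ∀ {W n} {P : Fin n → List V} → ClosedWalkFamily 0 W P
  ClosedWalkFamily-[] = (λ ()) , (λ ()) , (λ _ → z≤n) , (λ ()) , (λ { {()} }) , (λ ())

  closedWalkFamily₁ : ∀ {W n} {P : Fin n → List V} →
    Linked Arc W → ClosedSubwalkThrough W P → ClosedWalkFamily 1 W P
  closedWalkFamily₁ W-linked (p , Z , Z⊑W , Z≢[] , Z-closed , Pₚ⊑Z) =
    (λ _ → Z) , (λ _ → (Z≢[] , Subwalk⇒Linked Z⊑W W-linked) , Z-closed) ,
    (λ v → subst (_≤ _) (sym (+-identityʳ _)) (ocClosed-Subwalk v Z≢[] Z⊑W)) ,
    (λ _ → p) , (λ { {zero} {zero} _ → refl }) , (λ _ → Pₚ⊑Z)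

  ClosedWalkFamily-∷ : ∀ m {k d} (R : Chain (m + suc k)) →
    ClosedSubwalkThrough (walk (prefix m R)) (path (prefix m R)) →
    ClosedWalkFamily d (walk (suffix m R)) (path (suffix m R)) →
    ClosedWalkFamily (suc d) (walk R) (path R)
  ClosedWalkFamily-∷ m {k} {d} R (p , Z₀ , Z₀⊑X , Z₀≢[] , Z₀-closed , Lₚ⊑Z₀)
                                 (Z , Z-closed , Z-oc , σ , σ-inj , L⊑Z) =
    Z′ , Z′-closed , Z′-oc , σ′ , σ′-inj , L⊑Z′
    where
    X = walk (prefix m R)
    q = thread R (m ↑ʳ zero)
    Y = walk (suffix m R)
    X≢[] = walk-≢[] (prefix m R)

    Z′ : Fin (suc d) → List V
    Z′ zero    = Z₀
    Z′ (suc i) = Z i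

    Z′-closed : ∀ i → IsClosedWalk G (Z′ i)
    Z′-closed zero    = (Z₀≢[] , Subwalk⇒Linked Z₀⊑X (walk-linked (prefix m R))) , Z₀-closed
    Z′-closed (suc i) = Z-closed i

    Z′-oc : ∀ v → sum (map (ocClosed G v) (tabulate Z′)) ≤ count G v (drop 1 (walk R))
    Z′-oc v = begin
      ocClosed G v Z₀ + sum (map (ocClosed G v) (tabulate Z))
        ≤⟨ +-mono-≤ (ocClosed-Subwalk v Z₀≢[] Z₀⊑X) (Z-oc v) ⟩
      count G v (drop 1 X) + count G v (drop 1 Y)
        ≤⟨ +-monoˡ-≤ _ (≤-trans (m≤m+n _ _) (≤-reflexive (sym (count-drop₁-glue v q X≢[])))) ⟩
      count G v (drop 1 (glue G X q)) + count G v (drop 1 Y)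
        ≡⟨ count-drop₁-glue v Y (glue-≢[] q X≢[]) ⟨
      count G v (drop 1 (glue G (glue G X q) Y))
        ≡⟨ cong (count G v ∘ drop 1) (walk-split m R) ⟨
      count G v (drop 1 (walk R)) ∎
      where open ≤-Reasoning

    σ′ : Fin (suc d) → Fin (suc (m + suc k))
    σ′ zero    = p ↑ˡ suc k
    σ′ (suc i) = suc m ↑ʳ σ i

    σ′-inj : Injective _≡_ _≡_ σ′
    σ′-inj {zero}  {zero}  _  = refl
    σ′-inj {zero}  {suc j} eq = contradiction eq (↑ˡ≢↑ʳ p (σ j))
    σ′-inj {suc i} {zero}  eq = contradiction (sym eq) (↑ˡ≢↑ʳ p (σ i))
    σ′-inj {suc i} {suc j} eq = cong suc (σ-inj (↑ʳ-injective (suc m) _ _ eq))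

    L⊑Z′ : ∀ i → Subwalk G (path R (σ′ i)) (Z′ i)
    L⊑Z′ zero    = Lₚ⊑Z₀
    L⊑Z′ (suc i) = L⊑Z i

  ≤-peel-block : ∀ {m d n} → suc d * suc m ≤ suc n → ∃[ k ] n ≡ m + k × d * suc m ≤ k
  ≤-peel-block {m} {d} (s≤s h) with m≤n⇒∃[o]m+o≡n h
  ... | o , eq = d * suc m + o , trans (sym eq) (+-assoc m _ o) , m≤m+n _ o

  closedWalks⊎untangled : ∀ m d {n} (R : Chain n) → d * suc m ≤ suc n →
    ClosedWalkFamily d (walk R) (path R) ⊎ UntangledSublinkage (suc m) (walk R) (path R)
  closedWalks⊎untangled m zero    R _ = inj₁ (ClosedWalkFamily-[] {W = walk R} {P = path R})
  closedWalks⊎untangled m (suc d) R h with ≤-peel-block {m} {d} h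
  ... | k , refl , h′ with untangled⊎ClosedSubwalk (prefix m R)
  ...   | inj₁ untangled = inj₂ (walk (prefix m R) , toThreadedLinkage (prefix m R) , prefix-Subwalk m R ,
                                 (λ i → i ↑ˡ k , refl) , ≤-refl , untangled)
  ...   | inj₂ (p , Z₀) with d | k
  ...     | zero   | k      =
    inj₁ (closedWalkFamily₁ {P = path R} (walk-linked R) (p ↑ˡ k , ClosedSubwalk-⊑ (prefix-Subwalk m R) Z₀))
  ...     | suc _  | zero   = contradiction h′ λ ()
  ...     | suc d′ | suc k′ with closedWalks⊎untangled m (suc d′) (suffix m R) h′
  ...       | inj₁ Zs = inj₁ (ClosedWalkFamily-∷ m R (p , Z₀) Zs)
  ...       | inj₂ U  = inj₂ (UntangledSublinkage-⊑ (suffix-Subwalk m R) (λ j → suc m ↑ʳ j , refl) U)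

  closedWalks⊎untangledᵀ : ∀ {W} (T : ThreadedLinkage G W) m d → d * suc m ≤ size T →
    ClosedWalkFamily d W (L T) ⊎ UntangledSublinkage (suc m) W (L T)
  closedWalks⊎untangledᵀ T m d h =
    subst (λ W → ClosedWalkFamily d W (L T) ⊎ UntangledSublinkage (suc m) W (L T)) (sym (W-concat T))
      (closedWalks⊎untangled m d (fromThreadedLinkage T) h)

  overlapOf-≤-walk : ∀ Zs W → (∀ v → sum (map (ocClosed G v) Zs) ≤ count G v (drop 1 W)) →
    overlapOf G (ocClosed G) Zs ≤ overlapOf G (ocWalk G) (W ∷ [])
  overlapOf-≤-walk Zs W bound =
    overlapOf-≤ (ocClosed G) Zs λ v → ≤-trans (bound v) (≤-trans (count-drop₁ v W) (count≤overlapOf v W))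

mainTheorem6 : ∀ {a b : Level} (G : Digraph a b) (W : List (Digraph.V G))
    (T : ThreadedLinkage G W) (α x d : ℕ) →
    overlapOf G (ocWalk G) (W ∷ []) ≡ α →
    1 ≤ x → 1 ≤ d →
    x * d + (d ∸ 1) ≤ size T →
    (Σ (Fin d → List (Digraph.V G)) λ Z →
       (∀ i → IsClosedWalk G (Z i)) ×
       overlapOf G (ocClosed G) (tabulate Z) ≤ α ×
       Σ (Fin d → Fin (size T)) λ P →
         Injective _≡_ _≡_ P ×
         (∀ i → Subwalk G (L T (P i)) (Z i)))
    ⊎
    (Σ (List (Digraph.V G)) λ W′ →
       Σ (ThreadedLinkage G W′) λ T′ →
         Subwalk G W′ W ×
         (∀ i → ∃[ j ] L T′ i ≡ L T j) ×
         x ≤ size T′ ×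
         Untangled T′)
mainTheorem6 G W T α (suc m) d refl _ _ bound
  with closedWalks⊎untangledᵀ G T m d (≤-trans (≤-reflexive (*-comm d (suc m))) (≤-trans (m≤m+n _ _) bound))
... | inj₁ (Z , closed , oc≤ , σ , σ-inj , through) =
  inj₁ (Z , closed , overlapOf-≤-walk G (tabulate Z) W oc≤ , σ , σ-inj , through)
... | inj₂ untangled = inj₂ untangled
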